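{- Let $a,b$ be integers with $a-1>b\ge 1$, let $\varphi(0)=0^a1$, $\varphi(1)=0^b1$, let $u_\beta=\lim_{n\to\infty}\varphi^n(0)$, and let $T(w)=0^b1\varphi(w)0^b$. Let $p$ be a palindrome in ${\cal L}(u_\beta)$. (i) If $p$ has center $\varepsilon$, then $T(p)$ has center $1$. (ii) If $p$ has center $0$, then $T(p)$ has center $0$ if $a$ is odd and center $\varepsilon$ if $a$ is even. (iii) If $p$ has center $1$, then $T(p)$ has center $0$ if $b$ is odd and center $\varepsilon$ if $b$ is even.
   Context: ${\cal L}(u_\beta)$ is the set of finite factors of $u_\beta$; a palindrome is a word equal to its reversal $\overline{w}$. The center of a palindrome $p$ of odd length is the letter $z\in\{0,1\}$ with $p=wz\overline{w}$; the center of a palindrome of even length is the empty word $\varepsilon$. -}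

module Defs where

open import Data.Nat using (ℕ; zero; suc; _+_; _<_)
open import Data.List using (List; []; _∷_; _++_; length; replicate; concatMap; reverse)
open import Data.Maybe using (Maybe; just; nothing)
open import Data.Product using (∃; ∃-syntax; _×_)
open import Relation.Binary.PropositionalEquality using (_≡_)

data Letter : Set where
  𝟎 𝟏 : Letter

Word : Set
Word = List Letter

φ-letter : ℕ → ℕ → Letter → Word
φ-letter a b 𝟎 = replicate a 𝟎 ++ 𝟏 ∷ []
φ-letter a b 𝟏 = replicate b 𝟎 ++ 𝟏 ∷ []

φ : ℕ → ℕ → Word → Word
φ a b w = concatMap (φ-letter a b) w

φ^ : ℕ → ℕ → ℕ → Word → Word
φ^ a b zero    w = w
φ^ a b (suc n) w = φ a b (φ^ a b n w)

-- i-th letter of a word (with a default when out of range).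
at : Word → ℕ → Letter
at []      _       = 𝟎
at (x ∷ w) zero    = x
at (x ∷ w) (suc i) = at w i

-- u_β = lim φ^n(0): its i-th letter is the i-th letter of φ^(i+1)(0)
-- (|φ^n(0)| ≥ n+1 and φ^n(0) is a prefix of φ^(n+1)(0) when a ≥ 1).
uβ : ℕ → ℕ → ℕ → Letter
uβ a b i = at (φ^ a b (suc i) (𝟎 ∷ [])) i

InLang : ℕ → ℕ → Word → Set
InLang a b p = ∃[ i ] ((k : ℕ) → k < length p → at p k ≡ uβ a b (i + k))

Palindrome : Word → Set
Palindrome p = p ≡ reverse p

-- Center of a palindrome: nothing = ε (p = w w̄), just z (p = w z w̄).
HasCenter : Word → Maybe Letter → Set
HasCenter p nothing  = ∃[ w ] (p ≡ w ++ reverse w)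
HasCenter p (just z) = ∃[ w ] (p ≡ w ++ z ∷ reverse w)

T : ℕ → ℕ → Word → Word
T a b w = replicate b 𝟎 ++ 𝟏 ∷ φ a b w ++ replicate b 𝟎

{-# OPTIONS --safe #-}
-- Every letter image φ(x) = 0ᵏ1 satisfies reverse(φ(x))·1 = 1·φ(x), hence reverse(φ(w))·1 = 1·φ(w̃) for all
-- words w. So for p = w z w̃ with z ∈ {ε, 0, 1}, T(p) = q̃ · 1φ(z) · q where q = φ(w̃)0ᵇ, and T(p) has the centre
-- of 1φ(z): this is 1 for z = ε, and for z = 0 (resp. 1) it is the centre of 0ᵃ (resp. 0ᵇ), fixed by parity.
module Submission where

open import Defs
open import Data.Nat using (ℕ; _≤_; _<_; _+_; _%_; _/_; _*_; zero; suc)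
open import Data.Nat.DivMod using (m≡m%n+[m/n]*n)
open import Data.Nat.Tactic.RingSolver using (solve-∀)
open import Data.Maybe using (Maybe; just; nothing)
open import Data.Product using (_×_; _,_)
open import Data.List using (List; []; _∷_; _++_; _∷ʳ_; replicate; reverse; [_])
open import Data.List.Properties
  using (++-identityʳ; ++-assoc; reverse-++; unfold-reverse; concatMap-++; reverse-involutive)
open import Relation.Binary.PropositionalEquality
  using (_≡_; refl; sym; trans; cong; cong₂; subst; module ≡-Reasoning)

private
  variable
    A : Set

replicate-+ : ∀ m n (x : A) → replicate (m + n) x ≡ replicate m x ++ replicate n x
replicate-+ zero    n x = refl
replicate-+ (suc m) n x = cong (x ∷_) (replicate-+ m n x)

replicate-∷ʳ : ∀ n (x : A) → replicate n x ∷ʳ x ≡ x ∷ replicate n x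
replicate-∷ʳ zero    x = refl
replicate-∷ʳ (suc n) x = cong (x ∷_) (replicate-∷ʳ n x)

reverse-replicate : ∀ n (x : A) → reverse (replicate n x) ≡ replicate n x
reverse-replicate zero    x = refl
reverse-replicate (suc n) x = begin
  reverse (x ∷ replicate n x)   ≡⟨ unfold-reverse x (replicate n x) ⟩
  reverse (replicate n x) ∷ʳ x  ≡⟨ cong (_∷ʳ x) (reverse-replicate n x) ⟩
  replicate n x ∷ʳ x            ≡⟨ replicate-∷ʳ n x ⟩
  x ∷ replicate n x             ∎
  where open ≡-Reasoning

mirror-++ : ∀ (q w mid : List A) →
            reverse q ++ (w ++ mid ++ reverse w) ++ q ≡ (reverse q ++ w) ++ mid ++ reverse (reverse q ++ w)
mirror-++ q w mid = begin
  reverse q ++ (w ++ mid ++ reverse w) ++ q         ≡⟨ cong (reverse q ++_) (++-assoc w _ q) ⟩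
  reverse q ++ w ++ (mid ++ reverse w) ++ q         ≡⟨ cong (λ t → reverse q ++ w ++ t) (++-assoc mid _ q) ⟩
  reverse q ++ w ++ mid ++ reverse w ++ q           ≡⟨ sym (++-assoc (reverse q) w _) ⟩
  (reverse q ++ w) ++ mid ++ reverse w ++ q         ≡⟨ cong (λ t → (reverse q ++ w) ++ mid ++ reverse w ++ t)
                                                          (sym (reverse-involutive q)) ⟩
  (reverse q ++ w) ++ mid ++ reverse w ++ reverse (reverse q)
                                                    ≡⟨ cong (λ t → (reverse q ++ w) ++ mid ++ t)
                                                          (sym (reverse-++ (reverse q) w)) ⟩
  (reverse q ++ w) ++ mid ++ reverse (reverse q ++ w) ∎
  where open ≡-Reasoning

HasCenter-mirror : ∀ (q : Word) {u} c → HasCenter u c → HasCenter (reverse q ++ u ++ q) c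
HasCenter-mirror q nothing  (w , refl) = reverse q ++ w , mirror-++ q w []
HasCenter-mirror q (just z) (w , refl) = reverse q ++ w , mirror-++ q w [ z ]

replicate-center : ∀ n {r} (x : Letter) {c} → n % 2 ≡ r → HasCenter (replicate r x) c → HasCenter (replicate n x) c
replicate-center n {r} x {c} refl h = subst (λ t → HasCenter t c) halves (HasCenter-mirror (replicate m x) c h)
  where
  m : ℕ
  m = n / 2
  r+m*2≡m+[r+m] : ∀ r m → r + m * 2 ≡ m + (r + m)
  r+m*2≡m+[r+m] = solve-∀
  halves : reverse (replicate m x) ++ replicate r x ++ replicate m x ≡ replicate n x
  halves = begin
    reverse (replicate m x) ++ replicate r x ++ replicate m x ≡⟨ cong (_++ replicate r x ++ replicate m x)
                                                                   (reverse-replicate m x) ⟩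
    replicate m x ++ replicate r x ++ replicate m x           ≡⟨ cong (replicate m x ++_) (sym (replicate-+ r m x)) ⟩
    replicate m x ++ replicate (r + m) x                      ≡⟨ sym (replicate-+ m (r + m) x) ⟩
    replicate (m + (r + m)) x                                 ≡⟨ cong (λ k → replicate k x)
                                                                   (sym (trans (m≡m%n+[m/n]*n n 2) (r+m*2≡m+[r+m] r m))) ⟩
    replicate n x                                             ∎
    where open ≡-Reasoning

reverse-0ᵏ1 : ∀ k → reverse (replicate k 𝟎 ++ [ 𝟏 ]) ≡ 𝟏 ∷ replicate k 𝟎
reverse-0ᵏ1 k = trans (reverse-++ (replicate k 𝟎) [ 𝟏 ]) (cong (𝟏 ∷_) (reverse-replicate k 𝟎))

centerWord : Maybe Letter → Word
centerWord nothing  = []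
centerWord (just z) = [ z ]

module _ (a b : ℕ) where

  φ-++ : ∀ u v → φ a b (u ++ v) ≡ φ a b u ++ φ a b v
  φ-++ = concatMap-++ (φ-letter a b)

  φ-[x] : ∀ x → φ a b [ x ] ≡ φ-letter a b x
  φ-[x] x = ++-identityʳ (φ-letter a b x)

  reverse-φ-letter : ∀ x → reverse (φ-letter a b x) ∷ʳ 𝟏 ≡ 𝟏 ∷ φ-letter a b x
  reverse-φ-letter 𝟎 = cong (_∷ʳ 𝟏) (reverse-0ᵏ1 a)
  reverse-φ-letter 𝟏 = cong (_∷ʳ 𝟏) (reverse-0ᵏ1 b)

  reverse-φ : ∀ w → reverse (φ a b w) ∷ʳ 𝟏 ≡ 𝟏 ∷ φ a b (reverse w)
  reverse-φ []      = refl
  reverse-φ (x ∷ w) = begin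
    reverse (φ-letter a b x ++ φ a b w) ∷ʳ 𝟏          ≡⟨ cong (_∷ʳ 𝟏) (reverse-++ (φ-letter a b x) (φ a b w)) ⟩
    (reverse (φ a b w) ++ reverse (φ-letter a b x)) ∷ʳ 𝟏
                                                      ≡⟨ ++-assoc (reverse (φ a b w)) _ [ 𝟏 ] ⟩
    reverse (φ a b w) ++ reverse (φ-letter a b x) ∷ʳ 𝟏 ≡⟨ cong (reverse (φ a b w) ++_) (reverse-φ-letter x) ⟩
    reverse (φ a b w) ++ 𝟏 ∷ φ-letter a b x           ≡⟨ sym (++-assoc (reverse (φ a b w)) [ 𝟏 ] _) ⟩
    (reverse (φ a b w) ∷ʳ 𝟏) ++ φ-letter a b x        ≡⟨ cong (_++ φ-letter a b x) (reverse-φ w) ⟩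
    𝟏 ∷ φ a b (reverse w) ++ φ-letter a b x           ≡⟨ cong (λ t → 𝟏 ∷ φ a b (reverse w) ++ t) (sym (φ-[x] x)) ⟩
    𝟏 ∷ φ a b (reverse w) ++ φ a b [ x ]              ≡⟨ cong (𝟏 ∷_) (sym (φ-++ (reverse w) [ x ])) ⟩
    𝟏 ∷ φ a b (reverse w ∷ʳ x)                        ≡⟨ cong (λ t → 𝟏 ∷ φ a b t) (sym (unfold-reverse x w)) ⟩
    𝟏 ∷ φ a b (reverse (x ∷ w))                       ∎
    where open ≡-Reasoning

  T-mirror : ∀ w mid → let q = φ a b (reverse w) ++ replicate b 𝟎 in
             T a b (w ++ mid ++ reverse w) ≡ reverse q ++ (𝟏 ∷ φ a b mid) ++ q
  T-mirror w mid = begin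
    Z ++ 𝟏 ∷ φ a b (w ++ mid ++ w̃) ++ Z               ≡⟨ cong (λ t → Z ++ 𝟏 ∷ t ++ Z) φ-split ⟩
    Z ++ 𝟏 ∷ (φ a b w ++ φ a b mid ++ φ a b w̃) ++ Z    ≡⟨ cong (λ t → Z ++ 𝟏 ∷ t) (++-assoc (φ a b w) _ Z) ⟩
    Z ++ (𝟏 ∷ φ a b w) ++ (φ a b mid ++ φ a b w̃) ++ Z  ≡⟨ cong₂ (λ s t → Z ++ s ++ t) 𝟏∷φw (++-assoc (φ a b mid) _ Z) ⟩
    Z ++ (reverse (φ a b w̃) ∷ʳ 𝟏) ++ φ a b mid ++ q   ≡⟨ cong (Z ++_) (++-assoc (reverse (φ a b w̃)) [ 𝟏 ] _) ⟩
    Z ++ reverse (φ a b w̃) ++ 𝟏 ∷ φ a b mid ++ q       ≡⟨ sym (++-assoc Z (reverse (φ a b w̃)) _) ⟩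
    (Z ++ reverse (φ a b w̃)) ++ 𝟏 ∷ φ a b mid ++ q     ≡⟨ cong (_++ 𝟏 ∷ φ a b mid ++ q) reverse-q ⟩
    reverse q ++ 𝟏 ∷ φ a b mid ++ q                    ∎
    where
    open ≡-Reasoning
    Z = replicate b 𝟎
    w̃ = reverse w
    q = φ a b w̃ ++ Z
    φ-split : φ a b (w ++ mid ++ w̃) ≡ φ a b w ++ φ a b mid ++ φ a b w̃
    φ-split = trans (φ-++ w (mid ++ w̃)) (cong (φ a b w ++_) (φ-++ mid w̃))
    𝟏∷φw : 𝟏 ∷ φ a b w ≡ reverse (φ a b w̃) ∷ʳ 𝟏
    𝟏∷φw = sym (trans (reverse-φ w̃) (cong (λ t → 𝟏 ∷ φ a b t) (reverse-involutive w)))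
    reverse-q : Z ++ reverse (φ a b w̃) ≡ reverse q
    reverse-q = sym (trans (reverse-++ (φ a b w̃) Z) (cong (_++ reverse (φ a b w̃)) (reverse-replicate b 𝟎)))

  T-center : ∀ {p} c c′ → HasCenter p c → HasCenter (𝟏 ∷ φ a b (centerWord c)) c′ → HasCenter (T a b p) c′
  T-center nothing  c′ (w , refl) h =
    subst (λ t → HasCenter t c′) (sym (T-mirror w [])) (HasCenter-mirror _ c′ h)
  T-center (just z) c′ (w , refl) h =
    subst (λ t → HasCenter t c′) (sym (T-mirror w [ z ])) (HasCenter-mirror _ c′ h)

  zeros : Letter → ℕ
  zeros 𝟎 = a
  zeros 𝟏 = b

  φ-letter-zeros : ∀ x → φ-letter a b x ≡ replicate (zeros x) 𝟎 ++ [ 𝟏 ]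
  φ-letter-zeros 𝟎 = refl
  φ-letter-zeros 𝟏 = refl

  𝟏∷φ-[x]-center : ∀ x {c} → HasCenter (replicate (zeros x) 𝟎) c → HasCenter (𝟏 ∷ φ a b [ x ]) c
  𝟏∷φ-[x]-center x {c} h =
    subst (λ t → HasCenter (𝟏 ∷ t) c) (sym (trans (φ-[x] x) (φ-letter-zeros x))) (HasCenter-mirror [ 𝟏 ] c h)

  T-center-letter : ∀ {p} x → HasCenter p (just x) →
                    (zeros x % 2 ≡ 1 → HasCenter (T a b p) (just 𝟎)) × (zeros x % 2 ≡ 0 → HasCenter (T a b p) nothing)
  T-center-letter {p} x hp = (λ odd → center (just 𝟎) odd ([] , refl)) , (λ even → center nothing even ([] , refl))
    where
    center : ∀ {r} c → zeros x % 2 ≡ r → HasCenter (replicate r 𝟎) c → HasCenter (T a b p) c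
    center c parity hr = T-center (just x) c hp (𝟏∷φ-[x]-center x (replicate-center (zeros x) 𝟎 parity hr))

lemma5p11 : (a b : ℕ) → 1 ≤ b → b + 1 < a → (p : Word) → Palindrome p → InLang a b p →
    (HasCenter p nothing → HasCenter (T a b p) (just 𝟏))
    × (HasCenter p (just 𝟎) → (a % 2 ≡ 1 → HasCenter (T a b p) (just 𝟎)) × (a % 2 ≡ 0 → HasCenter (T a b p) nothing))
    × (HasCenter p (just 𝟏) → (b % 2 ≡ 1 → HasCenter (T a b p) (just 𝟎)) × (b % 2 ≡ 0 → HasCenter (T a b p) nothing))
lemma5p11 a b _ _ _ _ _ =
  (λ hp → T-center a b nothing (just 𝟏) hp ([] , refl)) , T-center-letter a b 𝟎 , T-center-letter a b 𝟏
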